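{- Let $n\ge 4$ be an integer. If $G$ is a connected $2^*$-dense graph with $n$ vertices and $m$ edges, then $n-1\le m\le \binom{n-2}{2}+n-1$. Moreover, for every integer $a$ with $n-1\le a\le \binom{n-2}{2}+n-1$, there is a connected $2^*$-dense graph with $n$ vertices and $a$ edges.
   Context: All graphs are finite and simple. For an edge $uv$ of a graph $G$, the edge multiplicity is $m_G(uv)=|N_G(u)\cap N_G(v)|$. For an integer $k\ge 2$, a graph $G$ is called $k$-dense if $G$ has no isolated vertices and every edge $uv$ of $G$ satisfies $m_G(uv)\ge k-2$. A graph is $k^*$-dense if it is $k$-dense but not $(k+1)$-dense. -}

module Defs where

open import Data.Nat using (ℕ; zero; suc; _+_; _∸_; _≤_)
open import Data.Bool using (Bool; true; false; if_then_else_; _∧_)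
open import Data.Fin using (Fin; toℕ) renaming (zero to fzero; suc to fsuc)
open import Data.Nat using (_<ᵇ_)
open import Data.Product using (Σ; _×_; ∃)
open import Relation.Binary.PropositionalEquality using (_≡_)
open import Relation.Nullary using (¬_)

record Graph (n : ℕ) : Set where
  field
    adj    : Fin n → Fin n → Bool
    sym    : ∀ i j → adj i j ≡ adj j i
    irrefl : ∀ i → adj i i ≡ false
open Graph public

sumF : ∀ {n} → (Fin n → ℕ) → ℕ
sumF {zero}  f = 0
sumF {suc n} f = f fzero + sumF (λ i → f (fsuc i))

countF : ∀ {n} → (Fin n → Bool) → ℕ
countF f = sumF (λ i → if f i then 1 else 0)

Adj : ∀ {n} → Graph n → Fin n → Fin n → Set
Adj G u v = adj G u v ≡ true

edges : ∀ {n} → Graph n → ℕ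
edges G = sumF (λ i → countF (λ j → adj G i j ∧ (toℕ i <ᵇ toℕ j)))

mult : ∀ {n} → Graph n → Fin n → Fin n → ℕ
mult G u v = countF (λ w → adj G u w ∧ adj G v w)

NoIsolated : ∀ {n} → Graph n → Set
NoIsolated {n} G = ∀ (v : Fin n) → ∃ λ w → Adj G v w

-- k-dense (intended for k ≥ 2)
Dense : ∀ {n} → ℕ → Graph n → Set
Dense k G = NoIsolated G × (∀ u v → Adj G u v → k ∸ 2 ≤ mult G u v)

StarDense : ∀ {n} → ℕ → Graph n → Set
StarDense k G = Dense k G × ¬ Dense (suc k) G

data Reach {n} (G : Graph n) : Fin n → Fin n → Set where
  here : ∀ {u} → Reach G u u
  step : ∀ {u v w} → Adj G u v → Reach G v w → Reach G u w

Connected : ∀ {n} → Graph n → Set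
Connected {n} G = ∀ (u v : Fin n) → Reach G u v

-- A graph is 2-dense iff it has no isolated vertex, so a 2*-dense graph is
-- one without isolated vertices having an edge uv whose endpoints have no
-- common neighbour.  For such a connected graph on n = R + 2 vertices:
--   * lower bound: in a connected graph every vertex other than a root has
--     a neighbour strictly closer to the root; these n - 1 "parent" edges
--     are distinct, and the handshake lemma (degree sum = 2 * edges) gives
--     edges >= n - 1;
--   * upper bound: every vertex w outside {u, v} is adjacent to at most one
--     of u, v, hence has degree <= R, while deg u + deg v <= R + 2; so the
--     degree sum is at most R * R + R + 2 = 2 * (C(R,2) + R + 1).
-- Sharpness: join a dominating vertex 0 and a pendant vertex 1 (attached only
-- to 0) to a threshold graph on R vertices with any prescribed number
-- t <= C(R,2) of edges; the edge {0,1} has no common neighbour and the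
-- result has R + 1 + t edges.
module Submission where

open import Defs
open import Data.Nat using (ℕ; _+_; _∸_; _≤_)
open import Data.Nat.Combinatorics using (_C_)
open import Data.Product using (Σ; _×_)
open import Relation.Binary.PropositionalEquality using (_≡_)

open import Data.Nat using (zero; suc; _<_; _*_; z≤n; s≤s; _<ᵇ_; _⊓_; _≤?_)
open import Data.Nat.Properties
  using ( ≤-refl; ≤-reflexive; ≤-trans; <-asym; ≮⇒≥; <⇒≱; ≰⇒>; n<1⇒n≡0
        ; +-comm; +-assoc; +-identityʳ; *-identityʳ; m+n≡0⇒m≡0; m+n≡0⇒n≡0
        ; +-mono-≤; +-monoˡ-≤; +-monoʳ-≤; +-mono-<; +-cancelʳ-≤
        ; m≤n+o⇒m∸n≤o; m+[n∸m]≡n; m⊓n+n∸m≡n; module ≤-Reasoning )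
open import Data.Nat.Combinatorics using (nCk+nC[k+1]≡[n+1]C[k+1]; nC1≡n)
open import Data.Nat.Tactic.RingSolver using (solve-∀)
open import Data.Bool using (Bool; true; false; if_then_else_; _∧_)
import Data.Bool as Bool
open import Data.Bool.Properties using (∧-identityʳ; ∧-zeroʳ)
open import Data.Fin using (Fin; toℕ; _≟_) renaming (zero to fzero; suc to fsuc)
open import Data.Fin.Properties using (¬∀⟶∃¬; all?; any?; suc-injective)
open import Data.Product using (_,_; proj₁; proj₂; ∃)
open import Data.Sum using (_⊎_; inj₁; inj₂)
open import Data.Empty using (⊥-elim)
open import Function using (_∘_)
open import Relation.Nullary using (¬_; Dec; yes; no; does)
open import Relation.Nullary.Decidable using (_→-dec_; _×-dec_)
open import Relation.Unary using (Decidable)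
open import Relation.Binary.PropositionalEquality
  using (refl; cong; cong₂; trans; subst; _≢_; module ≡-Reasoning)
  renaming (sym to ≡-sym)

ind : Bool → ℕ
ind b = if b then 1 else 0

ind≤1 : ∀ b → ind b ≤ 1
ind≤1 true  = ≤-refl
ind≤1 false = z≤n

ind-disjoint : ∀ a b → a ∧ b ≡ false → ind a + ind b ≤ 1
ind-disjoint true  false _ = ≤-refl
ind-disjoint false true  _ = ≤-refl
ind-disjoint false false _ = z≤n

ind≡0 : ∀ {b} → ind b ≡ 0 → b ≡ false
ind≡0 {false} _ = refl

δ : ∀ {n} → Fin n → Fin n → ℕ
δ i j = ind (does (i ≟ j))

δ-off : ∀ {n} {i j : Fin n} → i ≢ j → δ i j ≡ 0
δ-off {i = i} {j} i≢j with i ≟ j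
... | yes i≡j = ⊥-elim (i≢j i≡j)
... | no  _   = refl

sumF-cong : ∀ {n} {f g : Fin n → ℕ} → (∀ i → f i ≡ g i) → sumF f ≡ sumF g
sumF-cong {zero}  h = refl
sumF-cong {suc n} h = cong₂ _+_ (h fzero) (sumF-cong (h ∘ fsuc))

sumF-mono : ∀ {n} {f g : Fin n → ℕ} → (∀ i → f i ≤ g i) → sumF f ≤ sumF g
sumF-mono {zero}  h = z≤n
sumF-mono {suc n} h = +-mono-≤ (h fzero) (sumF-mono (h ∘ fsuc))

sumF-zero : ∀ {n} {f : Fin n → ℕ} → (∀ i → f i ≡ 0) → sumF f ≡ 0
sumF-zero {zero}  h = refl
sumF-zero {suc n} h = cong₂ _+_ (h fzero) (sumF-zero (h ∘ fsuc))

sumF-ones : ∀ n → sumF {n} (λ _ → 1) ≡ n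
sumF-ones zero    = refl
sumF-ones (suc n) = cong suc (sumF-ones n)

sumF-zero⁻¹ : ∀ {n} (f : Fin n → ℕ) → sumF f ≡ 0 → ∀ i → f i ≡ 0
sumF-zero⁻¹ f e fzero    = m+n≡0⇒m≡0 (f fzero) e
sumF-zero⁻¹ f e (fsuc i) = sumF-zero⁻¹ (f ∘ fsuc) (m+n≡0⇒n≡0 (f fzero) e) i

sumF-+ : ∀ {n} (f g : Fin n → ℕ) → sumF (λ i → f i + g i) ≡ sumF f + sumF g
sumF-+ {zero}  f g = refl
sumF-+ {suc n} f g = begin
    (f fzero + g fzero) + sumF (λ i → f (fsuc i) + g (fsuc i))
  ≡⟨ cong ((f fzero + g fzero) +_) (sumF-+ (f ∘ fsuc) (g ∘ fsuc)) ⟩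
    (f fzero + g fzero) + (sumF (f ∘ fsuc) + sumF (g ∘ fsuc))
  ≡⟨ +-assoc-swap (f fzero) (g fzero) _ _ ⟩
    (f fzero + sumF (f ∘ fsuc)) + (g fzero + sumF (g ∘ fsuc)) ∎
  where
    open ≡-Reasoning
    +-assoc-swap : ∀ a b c d → (a + b) + (c + d) ≡ (a + c) + (b + d)
    +-assoc-swap = solve-∀

sumF-swap : ∀ {n m} (f : Fin n → Fin m → ℕ) →
  sumF (λ i → sumF (f i)) ≡ sumF (λ j → sumF (λ i → f i j))
sumF-swap {zero} {m} f = ≡-sym (sumF-zero {m} (λ _ → refl))
sumF-swap {suc n} f = trans (cong (sumF (f fzero) +_) (sumF-swap (f ∘ fsuc)))
  (≡-sym (sumF-+ (f fzero) (λ j → sumF (λ i → f (fsuc i) j))))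

sumF-bounded : ∀ {n k} {f : Fin n → ℕ} → (∀ i → f i ≤ k) → sumF f ≤ n * k
sumF-bounded {zero}  h = z≤n
sumF-bounded {suc n} h = +-mono-≤ (h fzero) (sumF-bounded (h ∘ fsuc))

δ-sum : ∀ {n} (c : Fin n) → sumF (δ c) ≡ 1
δ-sum {suc n} fzero    = cong suc (sumF-zero {n} (λ _ → refl))
δ-sum {suc n} (fsuc c) = δ-sum c

sumF-except₁ : ∀ {m k} (f : Fin (suc m) → ℕ) u →
  (∀ j → j ≢ u → f j ≤ k) → sumF f ≤ f u + m * k
sumF-except₁ f fzero h = +-monoʳ-≤ (f fzero) (sumF-bounded (λ j → h (fsuc j) λ ()))
sumF-except₁ {suc m} {k} f (fsuc u) h = begin
    f fzero + sumF (f ∘ fsuc)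
  ≤⟨ +-mono-≤ (h fzero λ ()) (sumF-except₁ (f ∘ fsuc) u (λ j j≢u → h (fsuc j) (j≢u ∘ suc-injective))) ⟩
    k + (f (fsuc u) + m * k)
  ≡⟨ move-first k (f (fsuc u)) m ⟩
    f (fsuc u) + suc m * k ∎
  where
    open ≤-Reasoning
    move-first : ∀ k a m → k + (a + m * k) ≡ a + suc m * k
    move-first = solve-∀

sumF-except₂ : ∀ {m k} (f : Fin (suc (suc m)) → ℕ) u v → u ≢ v →
  (∀ j → j ≢ u → j ≢ v → f j ≤ k) → sumF f ≤ (f u + f v) + m * k
sumF-except₂ f fzero fzero u≢v h = ⊥-elim (u≢v refl)
sumF-except₂ {m} {k} f fzero (fsuc v) u≢v h = begin
    f fzero + sumF (f ∘ fsuc)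
  ≤⟨ +-monoʳ-≤ (f fzero) (sumF-except₁ (f ∘ fsuc) v (λ j j≢v → h (fsuc j) (λ ()) (j≢v ∘ suc-injective))) ⟩
    f fzero + (f (fsuc v) + m * k)
  ≡⟨ ≡-sym (+-assoc (f fzero) (f (fsuc v)) (m * k)) ⟩
    (f fzero + f (fsuc v)) + m * k ∎
  where open ≤-Reasoning
sumF-except₂ {m} {k} f (fsuc u) fzero u≢v h = begin
    f fzero + sumF (f ∘ fsuc)
  ≤⟨ +-monoʳ-≤ (f fzero) (sumF-except₁ (f ∘ fsuc) u (λ j j≢u → h (fsuc j) (j≢u ∘ suc-injective) (λ ()))) ⟩
    f fzero + (f (fsuc u) + m * k)
  ≡⟨ swap-first (f fzero) (f (fsuc u)) (m * k) ⟩
    (f (fsuc u) + f fzero) + m * k ∎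
  where
    open ≤-Reasoning
    swap-first : ∀ a b c → a + (b + c) ≡ (b + a) + c
    swap-first = solve-∀
sumF-except₂ {zero} f (fsuc fzero) (fsuc fzero) u≢v h = ⊥-elim (u≢v refl)
sumF-except₂ {suc m} {k} f (fsuc u) (fsuc v) u≢v h = begin
    f fzero + sumF (f ∘ fsuc)
  ≤⟨ +-mono-≤ (h fzero (λ ()) (λ ()))
       (sumF-except₂ (f ∘ fsuc) u v (u≢v ∘ cong fsuc)
         (λ j j≢u j≢v → h (fsuc j) (j≢u ∘ suc-injective) (j≢v ∘ suc-injective))) ⟩
    k + ((f (fsuc u) + f (fsuc v)) + m * k)
  ≡⟨ move-first k (f (fsuc u) + f (fsuc v)) m ⟩
    (f (fsuc u) + f (fsuc v)) + suc m * k ∎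
  where
    open ≤-Reasoning
    move-first : ∀ k a m → k + (a + m * k) ≡ a + suc m * k
    move-first = solve-∀

half : ∀ {a b} → a + a ≤ b + b → a ≤ b
half a+a≤b+b = ≮⇒≥ λ b<a → <⇒≱ (+-mono-< b<a b<a) a+a≤b+b

A : ∀ {n} → Graph n → Fin n → Fin n → ℕ
A G i j = ind (adj G i j)

degree : ∀ {n} → Graph n → Fin n → ℕ
degree G i = sumF (A G i)

upward : ∀ {n} → Graph n → Fin n → Fin n → ℕ
upward G i j = ind (adj G i j ∧ (toℕ i <ᵇ toℕ j))

<ᵇ-trichotomy : ∀ {n} (i j : Fin n) → i ≢ j →
  ((toℕ i <ᵇ toℕ j) ≡ true  × (toℕ j <ᵇ toℕ i) ≡ false) ⊎
  ((toℕ i <ᵇ toℕ j) ≡ false × (toℕ j <ᵇ toℕ i) ≡ true)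
<ᵇ-trichotomy fzero    fzero    i≢j = ⊥-elim (i≢j refl)
<ᵇ-trichotomy fzero    (fsuc j) i≢j = inj₁ (refl , refl)
<ᵇ-trichotomy (fsuc i) fzero    i≢j = inj₂ (refl , refl)
<ᵇ-trichotomy (fsuc i) (fsuc j) i≢j = <ᵇ-trichotomy i j (i≢j ∘ cong fsuc)

adj⇒≢ : ∀ {n} (G : Graph n) {i j} → Adj G i j → i ≢ j
adj⇒≢ G {i} ij refl with trans (≡-sym ij) (irrefl G i)
... | ()

A≡upward+upward : ∀ {n} (G : Graph n) i j → A G i j ≡ upward G i j + upward G j i
A≡upward+upward G i j with adj G i j in ij
... | false rewrite sym G j i | ij = refl
... | true with <ᵇ-trichotomy i j (adj⇒≢ G ij)
...   | inj₁ (i<j , j≮i) rewrite sym G j i | ij | i<j | j≮i = refl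
...   | inj₂ (i≮j , j<i) rewrite sym G j i | ij | i≮j | j<i = refl

handshake : ∀ {n} (G : Graph n) → sumF (degree G) ≡ edges G + edges G
handshake G = begin
    sumF (λ i → sumF (A G i))
  ≡⟨ sumF-cong (λ i → sumF-cong (A≡upward+upward G i)) ⟩
    sumF (λ i → sumF (λ j → upward G i j + upward G j i))
  ≡⟨ sumF-cong (λ i → sumF-+ (upward G i) (λ j → upward G j i)) ⟩
    sumF (λ i → sumF (upward G i) + sumF (λ j → upward G j i))
  ≡⟨ sumF-+ (λ i → sumF (upward G i)) (λ i → sumF (λ j → upward G j i)) ⟩
    edges G + sumF (λ i → sumF (λ j → upward G j i))
  ≡⟨ cong (edges G +_) (sumF-swap (λ i j → upward G j i)) ⟩
    edges G + edges G ∎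
  where open ≡-Reasoning

least : {P : ℕ → Set} → Decidable P → ∀ {N} → P N →
  Σ ℕ λ k → P k × (∀ j → P j → k ≤ j)
least P? {zero} p = 0 , p , λ _ _ → z≤n
least P? {suc N} p with P? 0
... | yes p₀ = 0 , p₀ , λ _ _ → z≤n
... | no ¬p₀ with least (P? ∘ suc) p
...   | k , pₖ , minimal = suc k , pₖ , λ
  { zero    p₀ → ⊥-elim (¬p₀ p₀)
  ; (suc j) pⱼ → s≤s (minimal j pⱼ) }

-- Breadth-first
-- distances from the root 0 give every other vertex a parent, a neighbour
-- strictly closer to the root; the parent edges are pairwise distinct.
module ConnectedLowerBound {m} (G : Graph (suc m)) (conn : Connected G) where

  Within : ℕ → Fin (suc m) → Set
  Within zero    v = v ≡ fzero
  Within (suc k) v = ∃ λ w → Adj G v w × Within k w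

  within? : ∀ k → Decidable (Within k)
  within? zero    v = v ≟ fzero
  within? (suc k) v = any? (λ w → (adj G v w Bool.≟ true) ×-dec within? k w)

  reach⇒within : ∀ {v} → Reach G v fzero → ∃ λ k → Within k v
  reach⇒within here = 0 , refl
  reach⇒within (step {v = w} vw r) with reach⇒within r
  ... | k , wₖ = suc k , w , vw , wₖ

  closest : ∀ v → Σ ℕ λ k → Within k v × (∀ j → Within j v → k ≤ j)
  closest v = least (λ k → within? k v) (proj₂ (reach⇒within (conn v fzero)))

  dist : Fin (suc m) → ℕ
  dist v = proj₁ (closest v)

  -- Every non-root vertex has a neighbour strictly closer to the root
  -- (its distance is nonzero, since distance 0 would force it to be the root).
  parentΣ : ∀ i → Σ (Fin (suc m)) λ w → Adj G (fsuc i) w × dist w < dist (fsuc i)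
  parentΣ i with dist (fsuc i) | proj₁ (proj₂ (closest (fsuc i)))
  ... | suc k | w , iw , wₖ = w , iw , s≤s (proj₂ (proj₂ (closest w)) k wₖ)

  parent : Fin m → Fin (suc m)
  parent i = proj₁ (parentΣ i)

  tree : Fin (suc m) → Fin (suc m) → Bool
  tree fzero    y = false
  tree (fsuc i) y = does (parent i ≟ y)

  tree-step : ∀ x y → tree x y ≡ true → Adj G x y × dist y < dist x
  tree-step (fsuc i) y t with parent i ≟ y
  ... | yes refl = proj₂ (parentΣ i)

  tree≤A : ∀ x y → ind (tree x y) + ind (tree y x) ≤ A G x y
  tree≤A x y with tree x y in t₁ | tree y x in t₂
  ... | false | false = z≤n
  ... | true  | true  = ⊥-elim (<-asym (proj₂ (tree-step x y t₁)) (proj₂ (tree-step y x t₂)))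
  ... | true  | false rewrite proj₁ (tree-step x y t₁) = ≤-refl
  ... | false | true  rewrite sym G x y | proj₁ (tree-step y x t₂) = ≤-refl

  -- There are exactly m tree edges: one per non-root vertex.
  tree-count : sumF (λ x → sumF (λ y → ind (tree x y))) ≡ m
  tree-count = begin
      sumF (λ y → ind (tree fzero y)) + sumF (λ i → sumF (δ (parent i)))
    ≡⟨ cong₂ _+_ (sumF-zero {suc m} (λ _ → refl)) (sumF-cong (δ-sum ∘ parent)) ⟩
      sumF {m} (λ _ → 1)
    ≡⟨ sumF-ones m ⟩
      m ∎
    where open ≡-Reasoning

  -- Twice the tree edges are bounded by the degree sum.
  lower : m ≤ edges G
  lower = half (begin
      m + m
    ≡⟨ cong₂ _+_ (≡-sym tree-count) (≡-sym tree-count) ⟩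
      sumF (λ x → sumF (T x)) + sumF (λ x → sumF (T x))
    ≡⟨ cong (sumF (λ x → sumF (T x)) +_) (sumF-swap T) ⟩
      sumF (λ x → sumF (T x)) + sumF (λ x → sumF (λ y → T y x))
    ≡⟨ ≡-sym (sumF-+ (λ x → sumF (T x)) (λ x → sumF (λ y → T y x))) ⟩
      sumF (λ x → sumF (T x) + sumF (λ y → T y x))
    ≡⟨ sumF-cong (λ x → ≡-sym (sumF-+ (T x) (λ y → T y x))) ⟩
      sumF (λ x → sumF (λ y → T x y + T y x))
    ≤⟨ sumF-mono (λ x → sumF-mono (tree≤A x)) ⟩
      sumF (degree G)
    ≡⟨ handshake G ⟩
      edges G + edges G ∎)
    where
      open ≤-Reasoning
      T : Fin (suc m) → Fin (suc m) → ℕ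
      T x y = ind (tree x y)

pascal₂ : ∀ r → r + r C 2 ≡ suc r C 2
pascal₂ r = trans (cong (_+ r C 2) (≡-sym (nC1≡n r))) (nCk+nC[k+1]≡[n+1]C[k+1] r 1)

-- C(r,2) counts half of the r * r - r off-diagonal pairs.
C2-double : ∀ r → r C 2 + r C 2 + r ≡ r * r
C2-double zero    = refl
C2-double (suc r) = begin
    suc r C 2 + suc r C 2 + suc r
  ≡⟨ cong (λ x → x + x + suc r) (≡-sym (pascal₂ r)) ⟩
    (r + r C 2) + (r + r C 2) + suc r
  ≡⟨ regroup r (r C 2) ⟩
    (r C 2 + r C 2 + r) + (r + suc r)
  ≡⟨ cong (_+ (r + suc r)) (C2-double r) ⟩
    r * r + (r + suc r)
  ≡⟨ square-suc r ⟩
    suc r * suc r ∎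
  where
    open ≡-Reasoning
    regroup : ∀ r x → (r + x) + (r + x) + suc r ≡ (x + x + r) + (r + suc r)
    regroup = solve-∀
    square-suc : ∀ r → r * r + (r + suc r) ≡ suc r * suc r
    square-suc = solve-∀

degree-budget : ∀ R → (2 + R) + R * R ≡ (R C 2 + suc R) + (R C 2 + suc R)
degree-budget R = begin
    (2 + R) + R * R
  ≡⟨ cong ((2 + R) +_) (≡-sym (C2-double R)) ⟩
    (2 + R) + (R C 2 + R C 2 + R)
  ≡⟨ regroup R (R C 2) ⟩
    (R C 2 + suc R) + (R C 2 + suc R) ∎
  where
    open ≡-Reasoning
    regroup : ∀ R x → (2 + R) + (x + x + R) ≡ (x + suc R) + (x + suc R)
    regroup = solve-∀

module LonelyEdgeUpperBound {R} (G : Graph (suc (suc R))) (u v : Fin (suc (suc R)))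
         (uv : Adj G u v) (no-common : ∀ w → adj G u w ∧ adj G v w ≡ false) where

  one-endpoint : ∀ w → A G w u + A G w v ≤ 1
  one-endpoint w rewrite sym G w u | sym G w v = ind-disjoint (adj G u w) (adj G v w) (no-common w)

  endpoint-pairs : (A G u u + A G v u) + (A G u v + A G v v) ≡ 2
  endpoint-pairs rewrite irrefl G u | irrefl G v | sym G v u | uv = refl

  -- u and v share only the edge uv, so together they see at most R + 2 edge ends.
  endpoint-degrees : degree G u + degree G v ≤ 2 + R
  endpoint-degrees = begin
      degree G u + degree G v
    ≡⟨ ≡-sym (sumF-+ (A G u) (A G v)) ⟩
      sumF (λ j → A G u j + A G v j)
    ≤⟨ sumF-except₂ (λ j → A G u j + A G v j) u v (adj⇒≢ G uv)
         (λ j _ _ → ind-disjoint (adj G u j) (adj G v j) (no-common j)) ⟩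
      ((A G u u + A G v u) + (A G u v + A G v v)) + R * 1
    ≡⟨ cong₂ _+_ endpoint-pairs (*-identityʳ R) ⟩
      2 + R ∎
    where open ≤-Reasoning

  -- A vertex w outside {u, v} misses itself and one of u, v: degree <= R.
  -- Adding δ w to its row makes every entry at most 1 without changing
  -- the entries at u and v.
  other-degree : ∀ w → w ≢ u → w ≢ v → degree G w ≤ R
  other-degree w w≢u w≢v = +-cancelʳ-≤ 1 (degree G w) R (begin
      degree G w + 1
    ≡⟨ cong (degree G w +_) (≡-sym (δ-sum w)) ⟩
      degree G w + sumF (δ w)
    ≡⟨ ≡-sym (sumF-+ (A G w) (δ w)) ⟩
      sumF (λ j → A G w j + δ w j)
    ≤⟨ sumF-except₂ (λ j → A G w j + δ w j) u v (adj⇒≢ G uv) (λ j _ _ → row-entry j) ⟩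
      ((A G w u + δ w u) + (A G w v + δ w v)) + R * 1
    ≡⟨ cong₂ _+_ (cong₂ _+_ (drop-δ u w≢u) (drop-δ v w≢v)) (*-identityʳ R) ⟩
      (A G w u + A G w v) + R
    ≤⟨ +-monoˡ-≤ R (one-endpoint w) ⟩
      1 + R
    ≡⟨ +-comm 1 R ⟩
      R + 1 ∎)
    where
      open ≤-Reasoning
      row-entry : ∀ j → A G w j + δ w j ≤ 1
      row-entry j with w ≟ j
      ... | yes refl rewrite irrefl G w = ≤-refl
      ... | no  _    = ≤-trans (≤-reflexive (+-identityʳ (A G w j))) (ind≤1 _)
      drop-δ : ∀ x → w ≢ x → A G w x + δ w x ≡ A G w x
      drop-δ x w≢x = trans (cong (A G w x +_) (δ-off w≢x)) (+-identityʳ (A G w x))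

  degree-sum : sumF (degree G) ≤ (2 + R) + R * R
  degree-sum = begin
      sumF (degree G)
    ≤⟨ sumF-except₂ (degree G) u v (adj⇒≢ G uv) other-degree ⟩
      (degree G u + degree G v) + R * R
    ≤⟨ +-monoˡ-≤ (R * R) endpoint-degrees ⟩
      (2 + R) + R * R ∎
    where open ≤-Reasoning

  upper : edges G ≤ R C 2 + suc R
  upper = half (begin
      edges G + edges G
    ≡⟨ ≡-sym (handshake G) ⟩
      sumF (degree G)
    ≤⟨ degree-sum ⟩
      (2 + R) + R * R
    ≡⟨ degree-budget R ⟩
      (R C 2 + suc R) + (R C 2 + suc R) ∎)
    where open ≤-Reasoning

-- An edge uv counts towards 3-density iff u and v have a common neighbour.
HasCommonNeighbour : ∀ {n} → Graph n → Fin n → Fin n → Set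
HasCommonNeighbour G u v = Adj G u v → 1 ≤ mult G u v

hasCommonNeighbour? : ∀ {n} (G : Graph n) u v → Dec (HasCommonNeighbour G u v)
hasCommonNeighbour? G u v = (adj G u v Bool.≟ true) →-dec (1 ≤? mult G u v)

-- A 2*-dense graph has no isolated vertex, so its failure to be 3-dense is
-- witnessed by an edge uv of multiplicity 0: u and v have no common neighbour.
lonely-edge : ∀ {n} (G : Graph n) → StarDense 2 G →
  Σ (Fin n) λ u → Σ (Fin n) λ v → Adj G u v × (∀ w → adj G u w ∧ adj G v w ≡ false)
lonely-edge {n} G ((no-isolated , _) , not-3-dense)
  with ¬∀⟶∃¬ n (λ u → ∀ v → HasCommonNeighbour G u v) (all? ∘ hasCommonNeighbour? G)
         (λ all-common → not-3-dense (no-isolated , all-common))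
... | u , ¬u-common with ¬∀⟶∃¬ n (HasCommonNeighbour G u) (hasCommonNeighbour? G u) ¬u-common
... | v , ¬uv-common with adj G u v in uv
... | false = ⊥-elim (¬uv-common λ ())
... | true  = u , v , uv , λ w → ind≡0 (sumF-zero⁻¹ _ mult≡0 w)
  where
    mult≡0 : mult G u v ≡ 0
    mult≡0 = n<1⇒n≡0 (≰⇒> (λ 1≤mult → ¬uv-common (λ _ → 1≤mult)))

addVertex : ∀ {r} → Graph r → (Fin r → Bool) → Graph (suc r)
addVertex {r} G nb = record { adj = adj′ ; sym = sym′ ; irrefl = irrefl′ }
  where
    adj′ : Fin (suc r) → Fin (suc r) → Bool
    adj′ fzero    fzero    = false
    adj′ fzero    (fsuc j) = nb j
    adj′ (fsuc i) fzero    = nb i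
    adj′ (fsuc i) (fsuc j) = adj G i j
    sym′ : ∀ i j → adj′ i j ≡ adj′ j i
    sym′ fzero    fzero    = refl
    sym′ fzero    (fsuc j) = refl
    sym′ (fsuc i) fzero    = refl
    sym′ (fsuc i) (fsuc j) = sym G i j
    irrefl′ : ∀ i → adj′ i i ≡ false
    irrefl′ fzero    = refl
    irrefl′ (fsuc i) = irrefl G i

edges-addVertex : ∀ {r} (G : Graph r) nb → edges (addVertex G nb) ≡ countF nb + edges G
edges-addVertex {r} G nb = cong₂ _+_
  (sumF-cong {r} (λ j → cong ind (∧-identityʳ (nb j))))
  (sumF-cong {r} (λ i → cong (_+ countF (λ j → adj G i j ∧ (toℕ i <ᵇ toℕ j)))
                                (cong ind (∧-zeroʳ (nb i)))))

count-below : ∀ r t → countF {r} (λ k → toℕ k <ᵇ t) ≡ r ⊓ t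
count-below zero    t       = refl
count-below (suc r) zero    = sumF-zero {r} (λ _ → refl)
count-below (suc r) (suc t) = cong suc (count-below r t)

-- A threshold graph on r vertices with any prescribed number t <= C(r,2)
-- of edges: the newest vertex is joined to the first min(r-1, t) old ones.
threshold : (r t : ℕ) → Graph r
threshold zero    t = record { adj = λ () ; sym = λ () ; irrefl = λ () }
threshold (suc r) t = addVertex (threshold r (t ∸ r)) (λ k → toℕ k <ᵇ t)

-- The threshold graph has exactly t edges when t <= C(r,2): the newest
-- vertex contributes min(r, t) edges and the remaining t - r fit recursively.
edges-threshold : ∀ r t → t ≤ r C 2 → edges (threshold r t) ≡ t
edges-threshold zero    zero    _    = refl
edges-threshold (suc r) t       t≤C2 = begin
    edges (threshold (suc r) t)
  ≡⟨ edges-addVertex (threshold r (t ∸ r)) (λ k → toℕ k <ᵇ t) ⟩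
    countF {r} (λ k → toℕ k <ᵇ t) + edges (threshold r (t ∸ r))
  ≡⟨ cong₂ _+_ (count-below r t) (edges-threshold r (t ∸ r) (m≤n+o⇒m∸n≤o t r t≤r+C2)) ⟩
    r ⊓ t + (t ∸ r)
  ≡⟨ m⊓n+n∸m≡n r t ⟩
    t ∎
  where
    open ≡-Reasoning
    t≤r+C2 : t ≤ r + r C 2
    t≤r+C2 = subst (t ≤_) (≡-sym (pascal₂ r)) t≤C2

dominated : (r t : ℕ) → Graph (suc (suc r))
dominated r t = addVertex (addVertex (threshold r t) (λ _ → false)) (λ _ → true)

edges-dominated : ∀ r t → t ≤ r C 2 → edges (dominated r t) ≡ suc r + t
edges-dominated r t t≤C2 = begin
    edges (dominated r t)
  ≡⟨ edges-addVertex (addVertex (threshold r t) (λ _ → false)) (λ _ → true) ⟩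
    countF {suc r} (λ _ → true) + edges (addVertex (threshold r t) (λ _ → false))
  ≡⟨ cong (countF {suc r} (λ _ → true) +_) (edges-addVertex (threshold r t) (λ _ → false)) ⟩
    sumF {suc r} (λ _ → 1) + (countF {r} (λ _ → false) + edges (threshold r t))
  ≡⟨ cong₂ _+_ (sumF-ones (suc r)) (cong₂ _+_ (sumF-zero {r} (λ _ → refl)) (edges-threshold r t t≤C2)) ⟩
    suc r + t ∎
  where open ≡-Reasoning

-- Every vertex is joined to the dominating vertex 0.
dominated-connected : ∀ r t → Connected (dominated r t)
dominated-connected r t u v = via-root u (from-root v)
  where
    from-root : ∀ v → Reach (dominated r t) fzero v
    from-root fzero    = here
    from-root (fsuc j) = step refl here
    via-root : ∀ u {v} → Reach (dominated r t) fzero v → Reach (dominated r t) u v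
    via-root fzero    r₀ = r₀
    via-root (fsuc j) r₀ = step refl r₀

-- 2-dense as it has no isolated vertex; not 3-dense since the edge {0,1}
-- has no common neighbour.
dominated-2*-dense : ∀ r t → StarDense 2 (dominated r t)
dominated-2*-dense r t = (no-isolated , λ _ _ _ → z≤n) , λ (_ , dense3) → lonely (dense3 fzero (fsuc fzero) refl)
  where
    no-isolated : NoIsolated (dominated r t)
    no-isolated fzero    = fsuc fzero , refl
    no-isolated (fsuc j) = fzero , refl
    mult≡0 : mult (dominated r t) fzero (fsuc fzero) ≡ 0
    mult≡0 = sumF-zero no-common
      where
        no-common : ∀ w → ind (adj (dominated r t) fzero w ∧ adj (dominated r t) (fsuc fzero) w) ≡ 0
        no-common fzero           = refl
        no-common (fsuc fzero)    = refl
        no-common (fsuc (fsuc k)) = refl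
    lonely : ¬ 1 ≤ mult (dominated r t) fzero (fsuc fzero)
    lonely 1≤mult with subst (1 ≤_) mult≡0 1≤mult
    ... | ()

corollary7p1 : (n : ℕ) → 4 ≤ n →
    ((G : Graph n) → Connected G → StarDense 2 G →
    (n ∸ 1 ≤ edges G) × (edges G ≤ ((n ∸ 2) C 2) + (n ∸ 1)))
    × ((a : ℕ) → n ∸ 1 ≤ a → a ≤ ((n ∸ 2) C 2) + (n ∸ 1) →
    Σ (Graph n) (λ G → Connected G × StarDense 2 G × (edges G ≡ a)))
corollary7p1 (suc (suc R)) _ = bounds , realise
  where
    bounds : (G : Graph (suc (suc R))) → Connected G → StarDense 2 G →
      (suc R ≤ edges G) × (edges G ≤ R C 2 + suc R)
    bounds G conn star with lonely-edge G star
    ... | u , v , uv , no-common =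
      ConnectedLowerBound.lower G conn , LonelyEdgeUpperBound.upper G u v uv no-common

    -- Take t = a - (R + 1) edges inside the threshold part.
    realise : (a : ℕ) → suc R ≤ a → a ≤ R C 2 + suc R →
      Σ (Graph (suc (suc R))) (λ G → Connected G × StarDense 2 G × (edges G ≡ a))
    realise a lo hi = dominated R (a ∸ suc R) , dominated-connected R _ , dominated-2*-dense R _ ,
      trans (edges-dominated R (a ∸ suc R) t≤C2) (m+[n∸m]≡n lo)
      where
        t≤C2 : a ∸ suc R ≤ R C 2
        t≤C2 = m≤n+o⇒m∸n≤o a (suc R) (subst (a ≤_) (+-comm (R C 2) (suc R)) hi)
corollary7p1 (suc zero) (s≤s ())
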